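{- The competitive ratio of every deterministic algorithm for the online multiprocessor scheduling with testing problem on $m=2$ machines is greater than $2.2117$.
   Context: Online multiprocessor scheduling with testing on $m$ identical parallel machines: jobs $J_1,\dots,J_n$ arrive one by one in this order. When $J_j$ arrives, an upper bound $u_j\ge0$ and a testing time $t_j\ge0$ are revealed; its processing time $p_j\in[0,u_j]$ is unknown. Upon arrival the algorithm must irrevocably decide whether to test $J_j$ and on which machine to process it. An untested job occupies its machine for $u_j$ time; a tested job for $t_j+p_j$ time, $p_j$ being revealed after testing. The makespan $C^A(I)$ is the maximum machine load. With $\rho_j=\min\{u_j,t_j+p_j\}$, the optimal offline makespan $C^*(I)$ is the minimum over assignments of jobs to machines of the maximum over machines of the sum of $\rho_j$ of the jobs assigned to it. The competitive ratio of a deterministic algorithm $A$ is $\sup_I C^A(I)/C^*(I)$. -}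

module Defs where

open import Data.Bool using (Bool; true; false; if_then_else_)
open import Data.Fin using (Fin; _≟_)
open import Data.List using (List; []; _∷_; map; foldr; concatMap; allFin)
open import Data.List.Relation.Unary.All using (All)
open import Data.Maybe using (Maybe; just; nothing)
open import Data.Nat using (ℕ; zero; suc)
open import Data.Product using (_×_; _,_; proj₁; proj₂)
open import Data.Integer using (+_)
open import Data.Rational using (ℚ; 0ℚ; _+_; _*_; _⊔_; _⊓_; _≤_; _<_; _/_)
open import Relation.Nullary using (does)

-- A job: upper bound u, testing time t, (hidden) processing time p.
record Job : Set where
  constructor job
  field
    u t p : ℚ
open Job public

ValidJob : Job → Set
ValidJob j = (0ℚ ≤ u j) × (0ℚ ≤ t j) × (0ℚ ≤ p j) × (p j ≤ u j)

-- What the online algorithm has observed about an earlier job: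
-- its u, t, and p if (and only if) it was tested.
record Obs : Set where
  constructor obs
  field
    ou ot : ℚ
    op    : Maybe ℚ

-- A deterministic online algorithm on m machines: given the observations on
-- all previously arrived jobs (most recent first) and the (u, t) of the newly
-- arrived job, it irrevocably decides whether to test (true = test) and
-- on which machine to process it.
Algorithm : ℕ → Set
Algorithm m = List Obs → ℚ → ℚ → Bool × Fin m

occupy : Bool → Job → ℚ
occupy true  j = t j + p j
occupy false j = u j

-- Offline optimal processing time ρ_j = min(u_j, t_j + p_j).
ρ : Job → ℚ
ρ j = u j ⊓ (t j + p j)

run : ∀ {m} → Algorithm m → List Obs → List Job → List (ℚ × Fin m)
run A h [] = []
run A h (j ∷ js) with A h (u j) (t j)
... | (b , i) = (occupy b j , i) ∷
                run A (obs (u j) (t j) (if b then just (p j) else nothing) ∷ h) js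

load : ∀ {m} → List (ℚ × Fin m) → Fin m → ℚ
load [] i = 0ℚ
load ((x , k) ∷ xs) i = (if does (k ≟ i) then x else 0ℚ) + load xs i

-- Makespan: maximum machine load (all loads are ≥ 0).
makespan : ∀ {m} → List (ℚ × Fin m) → ℚ
makespan {m} xs = foldr _⊔_ 0ℚ (map (load xs) (allFin m))

CA : ∀ {m} → Algorithm m → List Job → ℚ
CA A I = makespan (run A [] I)

assignments : ∀ {m} → List ℚ → List (List (ℚ × Fin m))
assignments [] = [] ∷ []
assignments {m} (x ∷ xs) =
  concatMap (λ rest → map (λ i → (x , i) ∷ rest) (allFin m)) (assignments xs)

-- Minimum of a list (0 on the empty list; never used for m ≥ 1).
minimum : List ℚ → ℚ
minimum [] = 0ℚ
minimum (x ∷ xs) = foldr _⊓_ x xs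

Copt : (m : ℕ) → List Job → ℚ
Copt m I = minimum (map makespan (assignments {m} (map ρ I)))

c₀ : ℚ
c₀ = + 22117 / 10000

{-# OPTIONS --safe #-}
-- The adversary is a finite game tree. Each job's u and t are fixed in advance, but its
-- hidden p is chosen only after the algorithm has decided whether to test the job and
-- where to place it. A deterministic algorithm therefore follows a single root-to-leaf
-- path, and evaluation shows that at every leaf the instance built so far forces a
-- makespan above c₀ times the optimum.
module Submission where

open import Defs
open import Data.Bool using (Bool; true; false; if_then_else_)
open import Data.Fin using (Fin; zero; suc)
open import Data.Integer using (+_)
open import Data.List using (List; []; _∷_; map; concatMap; allFin; cartesianProduct)
open import Data.List.Membership.Propositional using (_∈_)
open import Data.List.Membership.Propositional.Properties
  using (∈-map⁺; ∈-concatMap⁺; ∈-cartesianProduct⁺; ∈-allFin)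
import Data.List.Relation.Unary.All as All
open import Data.List.Relation.Unary.All using (All)
open import Data.List.Relation.Unary.Any using (here; there)
import Data.List.Relation.Unary.Any as Any
open import Data.Maybe using (just; nothing)
open import Data.Nat using (ℕ)
open import Data.Product using (Σ; _×_; _,_; proj₁; proj₂)
open import Data.Rational using (ℚ; 0ℚ; _*_; _<_; _/_; _≤?_; _<?_)
open import Relation.Nullary using (Dec)
open import Relation.Nullary.Decidable using (_×-dec_; from-yes)
open import Relation.Binary.PropositionalEquality using (refl)

Decision : ℕ → Set
Decision m = Bool × Fin m

decisions : (m : ℕ) → List (Decision m)
decisions m = cartesianProduct (true ∷ false ∷ []) (allFin m)

∈-decisions : ∀ {m} (d : Decision m) → d ∈ decisions m
∈-decisions (b , i) = ∈-cartesianProduct⁺ (∈-booleans b) (∈-allFin i)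
  where
  ∈-booleans : (b : Bool) → b ∈ true ∷ false ∷ []
  ∈-booleans true  = here refl
  ∈-booleans false = there (here refl)

-- release u t react : announce a job (u, t); react d gives its processing time and the
-- rest of the game after the algorithm's decision d.
data Adversary (m : ℕ) : Set where
  stop    : Adversary m
  release : ℚ → ℚ → (Decision m → ℚ × Adversary m) → Adversary m

play : ∀ {m} → Algorithm m → List Obs → Adversary m → List Job
play A h stop = []
play A h (release u t react) with A h u t
... | (b , i) = job u t q ∷ play A h′ (proj₂ (react (b , i)))
  where
  q = proj₁ (react (b , i))
  h′ = obs u t (if b then just q else nothing) ∷ h

Outcome : ℕ → Set
Outcome m = List Job × List (ℚ × Fin m)

schedule : ∀ {m} → Decision m → Job → Outcome m → Outcome m
schedule (b , i) j (I , s) = j ∷ I , (occupy b j , i) ∷ s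

outcomes : ∀ {m} → Adversary m → List (Outcome m)
outcomesAfter : ∀ {m} → ℚ → ℚ → (Decision m → ℚ × Adversary m) → Decision m → List (Outcome m)

outcomes stop = ([] , []) ∷ []
outcomes {m} (release u t react) = concatMap (outcomesAfter u t react) (decisions m)

outcomesAfter u t react d =
  map (schedule d (job u t (proj₁ (react d)))) (outcomes (proj₂ (react d)))

play∈outcomes : ∀ {m} (A : Algorithm m) h (adv : Adversary m) →
  (play A h adv , run A h (play A h adv)) ∈ outcomes adv
play∈outcomes A h stop = here refl
play∈outcomes A h (release u t react) with A h u t
... | d = ∈-concatMap⁺ (outcomesAfter u t react)
  (Any.map (λ { refl → ∈-map⁺ (schedule d _) (play∈outcomes A _ (proj₂ (react d))) }) (∈-decisions d))

Refutes : (m : ℕ) → ℚ → Outcome m → Set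
Refutes m c (I , s) = All ValidJob I × 0ℚ < Copt m I × c * Copt m I < makespan s

validJob? : (j : Job) → Dec (ValidJob j)
validJob? j = (0ℚ ≤? u j) ×-dec (0ℚ ≤? t j) ×-dec (0ℚ ≤? p j) ×-dec (p j ≤? u j)

refutes? : ∀ m c (o : Outcome m) → Dec (Refutes m c o)
refutes? m c (I , s) = All.all? validJob? I ×-dec (0ℚ <? Copt m I) ×-dec (c * Copt m I <? makespan s)

byDecision : {X : Set} → X → X → X → X → Decision 2 → X
byDecision x _ _ _ (true  , zero)     = x
byDecision _ x _ _ (true  , suc zero) = x
byDecision _ _ x _ (false , zero)     = x
byDecision _ _ _ x (false , suc zero) = x

adversary : Adversary 2
adversary =
  release (+ 33 / 25) (+ 77 / 100)
    (byDecision
      (+ 33 / 25 , release (+ 89 / 100) (+ 53 / 100)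
          (byDecision
            (+ 17 / 20 , stop)
            (+ 89 / 100 , release (+ 221 / 100) (+ 17 / 25)
                (byDecision
                  (+ 221 / 100 , stop)
                  (0ℚ , release (+ 289 / 100) (+ 153 / 100)
                      (byDecision
                        (+ 289 / 100 , stop)
                        (+ 289 / 100 , stop)
                        (0ℚ , stop)
                        (0ℚ , stop)))
                  (0ℚ , stop)
                  (0ℚ , stop)))
            (0ℚ , stop)
            (0ℚ , release (+ 23 / 25) (+ 43 / 100)
                (byDecision
                  (+ 17 / 20 , stop)
                  (+ 22 / 25 , release (+ 74 / 25) (+ 33 / 20)
                      (byDecision
                        (+ 74 / 25 , stop)
                        (+ 74 / 25 , stop)
                        (0ℚ , stop)
                        (0ℚ , stop)))
                  (0ℚ , stop)
                  (0ℚ , release (+ 59 / 25) (+ 6 / 5)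
                      (byDecision
                        (+ 59 / 25 , stop)
                        (+ 59 / 25 , stop)
                        (0ℚ , stop)
                        (0ℚ , stop)))))))
      (+ 33 / 25 , release (+ 89 / 100) (+ 53 / 100)
          (byDecision
            (+ 89 / 100 , release (+ 221 / 100) (+ 17 / 25)
                (byDecision
                  (0ℚ , release (+ 289 / 100) (+ 153 / 100)
                      (byDecision
                        (+ 289 / 100 , stop)
                        (+ 289 / 100 , stop)
                        (0ℚ , stop)
                        (0ℚ , stop)))
                  (+ 221 / 100 , stop)
                  (0ℚ , stop)
                  (0ℚ , stop)))
            (+ 17 / 20 , stop)
            (0ℚ , release (+ 23 / 25) (+ 43 / 100)
                (byDecision
                  (+ 22 / 25 , release (+ 74 / 25) (+ 33 / 20)
                      (byDecision
                        (+ 74 / 25 , stop)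
                        (+ 74 / 25 , stop)
                        (0ℚ , stop)
                        (0ℚ , stop)))
                  (+ 17 / 20 , stop)
                  (0ℚ , release (+ 59 / 25) (+ 6 / 5)
                      (byDecision
                        (+ 59 / 25 , stop)
                        (+ 59 / 25 , stop)
                        (0ℚ , stop)
                        (0ℚ , stop)))
                  (0ℚ , stop)))
            (0ℚ , stop)))
      (0ℚ , release (+ 63 / 50) (+ 79 / 100)
          (byDecision
            (0ℚ , stop)
            (+ 63 / 50 , release (+ 37 / 20) (+ 71 / 100)
                (byDecision
                  (0ℚ , release (+ 69 / 25) (+ 7 / 5)
                      (byDecision
                        (+ 69 / 25 , stop)
                        (+ 69 / 25 , stop)
                        (0ℚ , stop)
                        (0ℚ , stop)))
                  (+ 37 / 20 , stop)
                  (0ℚ , release (+ 137 / 50) (+ 7 / 5)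
                      (byDecision
                        (+ 127 / 50 , stop)
                        (+ 137 / 50 , stop)
                        (0ℚ , stop)
                        (0ℚ , stop)))
                  (0ℚ , stop)))
            (0ℚ , stop)
            (0ℚ , release (+ 29 / 20) 0ℚ
                (byDecision
                  (0ℚ , release (+ 9 / 4) (+ 39 / 25)
                      (byDecision
                        (+ 9 / 4 , stop)
                        (+ 9 / 4 , stop)
                        (0ℚ , stop)
                        (0ℚ , stop)))
                  (0ℚ , release (+ 9 / 4) (+ 39 / 25)
                      (byDecision
                        (+ 9 / 4 , stop)
                        (+ 9 / 4 , stop)
                        (0ℚ , stop)
                        (0ℚ , stop)))
                  (0ℚ , stop)
                  (0ℚ , stop)))))
      (0ℚ , release (+ 63 / 50) (+ 79 / 100)
          (byDecision
            (+ 63 / 50 , release (+ 37 / 20) (+ 71 / 100)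
                (byDecision
                  (+ 37 / 20 , stop)
                  (0ℚ , release (+ 69 / 25) (+ 7 / 5)
                      (byDecision
                        (+ 69 / 25 , stop)
                        (+ 69 / 25 , stop)
                        (0ℚ , stop)
                        (0ℚ , stop)))
                  (0ℚ , stop)
                  (0ℚ , release (+ 137 / 50) (+ 7 / 5)
                      (byDecision
                        (+ 137 / 50 , stop)
                        (+ 127 / 50 , stop)
                        (0ℚ , stop)
                        (0ℚ , stop)))))
            (0ℚ , stop)
            (0ℚ , release (+ 29 / 20) 0ℚ
                (byDecision
                  (0ℚ , release (+ 9 / 4) (+ 39 / 25)
                      (byDecision
                        (+ 9 / 4 , stop)
                        (+ 9 / 4 , stop)
                        (0ℚ , stop)
                        (0ℚ , stop)))
                  (0ℚ , release (+ 9 / 4) (+ 39 / 25)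
                      (byDecision
                        (+ 9 / 4 , stop)
                        (+ 9 / 4 , stop)
                        (0ℚ , stop)
                        (0ℚ , stop)))
                  (0ℚ , stop)
                  (0ℚ , stop)))
            (0ℚ , stop))))

adversary-wins : All (Refutes 2 c₀) (outcomes adversary)
adversary-wins = from-yes (All.all? (refutes? 2 c₀) (outcomes adversary))

theorem6 : (A : Algorithm 2) →
    Σ (List Job) (λ I → All ValidJob I × (0ℚ < Copt 2 I) × (c₀ * Copt 2 I < CA A I))
theorem6 A = play A [] adversary , All.lookup adversary-wins (play∈outcomes A [] adversary)
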